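{- For any positive integer $s$ and any $s$ vectors $y_1,\dots,y_s\in\mathbb{Z}^E\setminus\{0\}$ with $\|y_i\|_1\le 4n^2$ for all $i$, there exists $w\in\mathcal W(n^3s)$ with $\langle y_i,w\rangle\neq0$ for every $i=1,\dots,s$.
   Context: $G=(V,E)$ is a fixed undirected simple graph with $n$ vertices, $n$ sufficiently large. Fix a numbering $E=\{e_1,\dots,e_{|E|}\}$. For an integer $t\ge7$, $\mathcal W(t)=\{w_k:k=2,\dots,t\}$ where $w_k:E\to\mathbb{Z}$ is given by $w_k(e_j)=(4n^2+1)^j\bmod k$. -}

module Defs where

open import Data.Nat as ℕ using (ℕ; zero; suc; _^_; _%_; NonZero)
open import Data.Nat.Properties using (<-strictTotalOrder)
open import Data.Integer as ℤ using (ℤ; +_; ∣_∣)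
open import Data.Fin using (Fin; toℕ)
open import Data.Fin.Properties using ()
open import Data.List using (List; length; lookup)
open import Data.List.Relation.Unary.All using (All)
open import Data.List.Relation.Unary.Unique.Propositional using (Unique)
open import Data.Product using (_×_; _,_; proj₁; proj₂)
open import Relation.Binary.PropositionalEquality using (_≡_)
open import Relation.Nullary using (¬_)

Σℤ : (m : ℕ) → (Fin m → ℤ) → ℤ
Σℤ zero    f = ℤ.+ 0
Σℤ (suc m) f = f Fin.zero ℤ.+ Σℤ m (λ j → f (Fin.suc j))
  where import Data.Fin as Fin

Σℕ : (m : ℕ) → (Fin m → ℕ) → ℕ
Σℕ zero    f = 0
Σℕ (suc m) f = f Fin.zero ℕ.+ Σℕ m (λ j → f (Fin.suc j))
  where import Data.Fin as Fin

-- A finite simple graph on vertex set Fin n, given together with a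
-- numbering of its edges: a duplicate-free list of edges {u,v},
-- each stored as (u , v) with u < v (so no loops, no repeated edges).
Edge : ℕ → Set
Edge n = Fin n × Fin n

record SimpleGraph (n : ℕ) : Set where
  field
    edges   : List (Edge n)
    ordered : All (λ e → toℕ (proj₁ e) ℕ.< toℕ (proj₂ e)) edges
    unique  : Unique edges

open SimpleGraph public

#E : ∀ {n} → SimpleGraph n → ℕ
#E G = length (edges G)

-- Vectors in ℤ^E, with E = {e_1,…,e_|E|} and e_{j+1} = lookup (edges G) j.
ℤ^E : ∀ {n} → SimpleGraph n → Set
ℤ^E G = Fin (#E G) → ℤ

-- w_k(e_j) = (4n²+1)^j mod k   (edge index j is 1-based: Fin index j ↦ j+1)
w : ∀ {n} (G : SimpleGraph n) (k : ℕ) .{{_ : NonZero k}} → ℤ^E G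
w {n} G k j = + ((4 ℕ.* n ℕ.* n ℕ.+ 1) ^ suc (toℕ j) % k)

‖_‖₁ : ∀ {n} {G : SimpleGraph n} → ℤ^E G → ℕ
‖_‖₁ {G = G} y = Σℕ (#E G) (λ j → ∣ y j ∣)

⟨_,_⟩ : ∀ {n} {G : SimpleGraph n} → ℤ^E G → ℤ^E G → ℤ
⟨_,_⟩ {G = G} y x = Σℤ (#E G) (λ j → y j ℤ.* x j)

NonZeroVec : ∀ {n} {G : SimpleGraph n} → ℤ^E G → Set
NonZeroVec y = ¬ (∀ j → y j ≡ + 0)

_∈𝒲_ : ∀ {n} {G : SimpleGraph n} → ℤ^E G → ℕ → Set
_∈𝒲_ {G = G} x t =
  Data.Product.Σ ℕ (λ k → 2 ℕ.≤ k × k ℕ.≤ t × ((kk : NonZero k) → ∀ j → x j ≡ w G k {{kk}} j))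
  where import Data.Product

-- Encode y as Y = Σ_j y_j M^(j+1) with M = 4n² + 1. Since |y_j| ≤ 4n² < M, base-M digits
-- are unique, so Y ≠ 0, and |Y| ≤ M^(|E|+1). Reducing the powers M^(j+1) modulo k turns Y
-- into ⟨y, w_k⟩, so if every w_k with 2 ≤ k ≤ n³s were orthogonal to some y_i, every such k
-- would divide the nonzero Q = Π_i |Y_i| ≤ M^(2n²s). But a nonzero common multiple of
-- K + 2, …, 2K + 2 is at least 2^(K+1), since (K + 2)⋯(2K + 2) divides K!·Q and is at least
-- 2^(K+1)(K+1)!; for K = ⌊(n-1)/2⌋ n² s and n ≥ 65 this exceeds M^(2n²s).

module Submission where

open import Defs

module IntegerSums where

  open import Data.Nat as ℕ using (ℕ; zero; suc; _^_; NonZero; z≤n)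
  open import Data.Nat.Divisibility using (_∣_; m∣m*n)
  import Data.Nat.Properties as ℕ
  open import Data.Nat.DivMod using (_%_; _/_; m≡m%n+[m/n]*n)
  open import Data.Integer using (ℤ; +_; -_; _+_; _*_; _-_; ∣_∣)
  open import Data.Integer.Properties
  open import Data.Integer.Tactic.RingSolver using (solve-∀)
  open import Data.Fin using (Fin; toℕ; zero; suc)
  open import Data.Product using (_×_; _,_)
  open import Function using (_∘_)
  open import Relation.Binary.PropositionalEquality

  Σℤ-cong : ∀ m {f g : Fin m → ℤ} → (∀ j → f j ≡ g j) → Σℤ m f ≡ Σℤ m g
  Σℤ-cong zero    f≗g = refl
  Σℤ-cong (suc m) f≗g = cong₂ _+_ (f≗g zero) (Σℤ-cong m (f≗g ∘ suc))

  Σℤ-+ : ∀ m (f g : Fin m → ℤ) → Σℤ m (λ j → f j + g j) ≡ Σℤ m f + Σℤ m g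
  Σℤ-+ zero    f g = refl
  Σℤ-+ (suc m) f g = trans (cong (_+_ (f zero + g zero)) (Σℤ-+ m (f ∘ suc) (g ∘ suc)))
                           (interchange (f zero) (g zero) _ _)
    where
    interchange : ∀ a b c d → a + b + (c + d) ≡ a + c + (b + d)
    interchange = solve-∀

  Σℤ-*ˡ : ∀ m c (f : Fin m → ℤ) → Σℤ m (λ j → c * f j) ≡ c * Σℤ m f
  Σℤ-*ˡ zero    c f = sym (*-zeroʳ c)
  Σℤ-*ˡ (suc m) c f = trans (cong (_+_ (c * f zero)) (Σℤ-*ˡ m c (f ∘ suc)))
                            (sym (*-distribˡ-+ c (f zero) _))

  Σℤ-scale : ∀ m c (f : Fin m → ℤ) (a : Fin m → ℕ) →
    Σℤ m (λ j → f j * + (c ℕ.* a j)) ≡ + c * Σℤ m (λ j → f j * + a j)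
  Σℤ-scale m c f a = trans (Σℤ-cong m λ j → trans (cong (f j *_) (pos-* c (a j))) (swap (f j) (+ c) _))
                           (Σℤ-*ˡ m (+ c) _)
    where
    swap : ∀ x y z → x * (y * z) ≡ y * (x * z)
    swap = solve-∀

  Σℤ-divMod : ∀ m k .{{_ : NonZero k}} (f : Fin m → ℤ) (a : Fin m → ℕ) →
    Σℤ m (λ j → f j * + a j) ≡ Σℤ m (λ j → f j * + (a j % k)) + + k * Σℤ m (λ j → f j * + (a j / k))
  Σℤ-divMod m k f a = begin
    Σℤ m (λ j → f j * + a j)                 ≡⟨ Σℤ-cong m term ⟩
    Σℤ m (λ j → remainders j + + k * quotients j)
                                             ≡⟨ Σℤ-+ m remainders (λ j → + k * quotients j) ⟩
    Σℤ m remainders + Σℤ m (λ j → + k * quotients j)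
                                             ≡⟨ cong (_+_ (Σℤ m remainders)) (Σℤ-*ˡ m (+ k) quotients) ⟩
    Σℤ m remainders + + k * Σℤ m quotients   ∎
    where
    open ≡-Reasoning
    remainders quotients : Fin m → ℤ
    remainders j = f j * + (a j % k)
    quotients  j = f j * + (a j / k)
    rearrange : ∀ x r q k → x * (r + q * k) ≡ x * r + k * (x * q)
    rearrange = solve-∀
    term : ∀ j → f j * + a j ≡ f j * + (a j % k) + + k * (f j * + (a j / k))
    term j = begin
      f j * + a j                                       ≡⟨ cong (λ b → f j * + b) (m≡m%n+[m/n]*n (a j) k) ⟩
      f j * + (a j % k ℕ.+ a j / k ℕ.* k)              ≡⟨ cong (f j *_) (trans (pos-+ (a j % k) _) (cong (_+_ (+ (a j % k))) (pos-* (a j / k) k))) ⟩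
      f j * (+ (a j % k) + + (a j / k) * + k)           ≡⟨ rearrange (f j) (+ (a j % k)) (+ (a j / k)) (+ k) ⟩
      f j * + (a j % k) + + k * (f j * + (a j / k))     ∎

  baseValue : ℕ → (m : ℕ) → (Fin m → ℤ) → ℤ
  baseValue b m f = Σℤ m (λ j → f j * + (b ^ toℕ j))

  baseValue-suc : ∀ b m (f : Fin (suc m) → ℤ) →
    baseValue b (suc m) f ≡ f zero + + b * baseValue b m (f ∘ suc)
  baseValue-suc b m f =
    cong₂ _+_ (*-identityʳ (f zero)) (Σℤ-scale m b (f ∘ suc) (λ j → b ^ toℕ j))

  d+b*v≡0⇒d≡0×v≡0 : ∀ {b} d v → ∣ d ∣ ℕ.< b → d + + b * v ≡ + 0 → d ≡ + 0 × v ≡ + 0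
  d+b*v≡0⇒d≡0×v≡0 {b} d v ∣d∣<b d+bv≡0 = ∣i∣≡0⇒i≡0 ∣d∣≡0 , ∣i∣≡0⇒i≡0 ∣v∣≡0
    where
    cancel : ∀ x y → x ≡ (x + y) - y
    cancel = solve-∀
    ∣d∣≡b*∣v∣ : ∣ d ∣ ≡ b ℕ.* ∣ v ∣
    ∣d∣≡b*∣v∣ = begin
      ∣ d ∣                          ≡⟨ cong ∣_∣ (cancel d (+ b * v)) ⟩
      ∣ (d + + b * v) - + b * v ∣    ≡⟨ cong (λ x → ∣ x - + b * v ∣) d+bv≡0 ⟩
      ∣ + 0 - + b * v ∣              ≡⟨ cong ∣_∣ (+-identityˡ (- (+ b * v))) ⟩
      ∣ - (+ b * v) ∣                ≡⟨ ∣-i∣≡∣i∣ (+ b * v) ⟩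
      ∣ + b * v ∣                    ≡⟨ abs-* (+ b) v ⟩
      b ℕ.* ∣ v ∣                    ∎
      where open ≡-Reasoning
    ∣v∣≡0 : ∣ v ∣ ≡ 0
    ∣v∣≡0 = ℕ.n<1⇒n≡0 (ℕ.*-cancelˡ-< b ∣ v ∣ 1
              (subst₂ ℕ._<_ ∣d∣≡b*∣v∣ (sym (ℕ.*-identityʳ b)) ∣d∣<b))
    ∣d∣≡0 : ∣ d ∣ ≡ 0
    ∣d∣≡0 = trans ∣d∣≡b*∣v∣ (trans (cong (b ℕ.*_) ∣v∣≡0) (ℕ.*-zeroʳ b))

  baseValue≡0⇒digits≡0 : ∀ b m (f : Fin m → ℤ) → (∀ j → ∣ f j ∣ ℕ.< b) →
    baseValue b m f ≡ + 0 → ∀ j → f j ≡ + 0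
  baseValue≡0⇒digits≡0 b (suc m) f ∣f∣<b value≡0 j
    with d+b*v≡0⇒d≡0×v≡0 (f zero) (baseValue b m (f ∘ suc)) (∣f∣<b zero)
                     (trans (sym (baseValue-suc b m f)) value≡0)
  ... | f₀≡0 , rest≡0 with j
  ...   | zero  = f₀≡0
  ...   | suc j = baseValue≡0⇒digits≡0 b m (f ∘ suc) (∣f∣<b ∘ suc) rest≡0 j

  ∣Σℤ*∣≤Σℕ∣∣*B : ∀ m (f : Fin m → ℤ) (a : Fin m → ℕ) B → (∀ j → a j ℕ.≤ B) →
    ∣ Σℤ m (λ j → f j * + a j) ∣ ℕ.≤ Σℕ m (λ j → ∣ f j ∣) ℕ.* B
  ∣Σℤ*∣≤Σℕ∣∣*B zero    f a B a≤B = z≤n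
  ∣Σℤ*∣≤Σℕ∣∣*B (suc m) f a B a≤B = begin
    ∣ f zero * + a zero + rest ∣            ≤⟨ ∣i+j∣≤∣i∣+∣j∣ (f zero * + a zero) rest ⟩
    ∣ f zero * + a zero ∣ ℕ.+ ∣ rest ∣       ≡⟨ cong (ℕ._+ ∣ rest ∣) (abs-* (f zero) (+ a zero)) ⟩
    ∣ f zero ∣ ℕ.* a zero ℕ.+ ∣ rest ∣       ≤⟨ ℕ.+-mono-≤ (ℕ.*-monoʳ-≤ ∣ f zero ∣ (a≤B zero))
                                                    (∣Σℤ*∣≤Σℕ∣∣*B m (f ∘ suc) (a ∘ suc) B (a≤B ∘ suc)) ⟩
    ∣ f zero ∣ ℕ.* B ℕ.+ Σℕ m (λ j → ∣ f (suc j) ∣) ℕ.* B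
                                            ≡⟨ ℕ.*-distribʳ-+ B ∣ f zero ∣ _ ⟨
    Σℕ (suc m) (λ j → ∣ f j ∣) ℕ.* B        ∎
    where
    open ℕ.≤-Reasoning
    rest = Σℤ m (λ j → f (suc j) * + a (suc j))

  Σℤ%≡0⇒∣Σℤ : ∀ m k .{{_ : NonZero k}} (f : Fin m → ℤ) (a : Fin m → ℕ) →
    Σℤ m (λ j → f j * + (a j % k)) ≡ + 0 → k ∣ ∣ Σℤ m (λ j → f j * + a j) ∣
  Σℤ%≡0⇒∣Σℤ m k f a Σ%≡0 = subst (k ∣_) (sym ∣Σ∣≡k*∣Σ/∣) (m∣m*n ∣ Σ/ ∣)
    where
    Σ/ = Σℤ m (λ j → f j * + (a j / k))
    ∣Σ∣≡k*∣Σ/∣ : ∣ Σℤ m (λ j → f j * + a j) ∣ ≡ k ℕ.* ∣ Σ/ ∣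
    ∣Σ∣≡k*∣Σ/∣ = begin
      ∣ Σℤ m (λ j → f j * + a j) ∣                  ≡⟨ cong ∣_∣ (Σℤ-divMod m k f a) ⟩
      ∣ Σℤ m (λ j → f j * + (a j % k)) + + k * Σ/ ∣  ≡⟨ cong (λ x → ∣ x + + k * Σ/ ∣) Σ%≡0 ⟩
      ∣ + 0 + + k * Σ/ ∣                             ≡⟨ cong ∣_∣ (+-identityˡ (+ k * Σ/)) ⟩
      ∣ + k * Σ/ ∣                                   ≡⟨ abs-* (+ k) Σ/ ⟩
      k ℕ.* ∣ Σ/ ∣                                    ∎
      where open ≡-Reasoning

open IntegerSums

open import Data.Nat as ℕ
  using (ℕ; zero; suc; _+_; _*_; _^_; _∸_; _≤_; _<_; _!; ⌊_/2⌋; NonZero; >-nonZero; ≢-nonZero; z≤n; s≤s; s≤s⁻¹)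
open import Data.Nat.Properties
open import Data.Nat.Divisibility using (_∣_; ∣m+n∣m⇒∣n; *-monoʳ-∣; ∣⇒≤; ∣-trans)
open import Data.Nat.Tactic.RingSolver using (solve-∀)
open import Data.Nat.ListAction using (product)
open import Data.Nat.ListAction.Properties using (∈⇒∣product; product≢0)
open import Data.Integer as ℤ using (ℤ; +_; ∣_∣)
open import Data.Integer.Properties using (abs-*; ∣i∣≡0⇒i≡0)
open import Data.Fin using (Fin; toℕ; zero; suc; combine)
open import Data.Fin.Properties using (toℕ<n; combine-injective; injective⇒≤; any?)
open import Data.List using (List; length; lookup; tabulate)
open import Data.List.Properties using (length-tabulate)
open import Data.List.Relation.Unary.All as All using (All; []; _∷_)
open import Data.List.Relation.Unary.All.Properties using (tabulate⁺)
open import Data.List.Relation.Unary.AllPairs using (_∷_)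
open import Data.List.Relation.Unary.Unique.Propositional using (Unique)
open import Data.List.Membership.Propositional.Properties using (∈-lookup; ∈-tabulate⁺)
open import Data.Product using (Σ; ∃; _×_; _,_; proj₁; proj₂)
open import Function using (_∘_)
open import Relation.Binary.PropositionalEquality
open import Relation.Nullary using (¬_; Dec; yes; no; ¬?; contradiction)
open import Relation.Nullary.Decidable using (decidable-stable)

rising : ℕ → ℕ → ℕ
rising m zero    = m
rising m (suc k) = rising m k * (m + suc k)

rising-suc : ∀ m k → rising m (suc k) ≡ m * rising (suc m) k
rising-suc m zero    = cong (m *_) (+-comm m 1)
rising-suc m (suc k) = begin
  rising m (suc k) * (m + suc (suc k))         ≡⟨ cong (_* (m + suc (suc k))) (rising-suc m k) ⟩
  m * rising (suc m) k * (m + suc (suc k))     ≡⟨ *-assoc m _ _ ⟩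
  m * (rising (suc m) k * (m + suc (suc k)))   ≡⟨ cong (λ x → m * (rising (suc m) k * x)) (+-suc m (suc k)) ⟩
  m * (rising (suc m) k * (suc m + suc k))     ∎
  where open ≡-Reasoning

-- (m + k + 1) · k! Q = m · k! Q + (k + 1)! Q, and rising m (k + 1) divides the left side
-- by the induction hypothesis at m and the first summand by the one at m + 1.
rising∣!* : ∀ k m Q → (∀ i → i ≤ k → m + i ∣ Q) → rising m k ∣ k ! * Q
rising∣!* zero m Q m+i∣Q =
  subst₂ _∣_ (+-identityʳ m) (sym (*-identityˡ Q)) (m+i∣Q 0 z≤n)
rising∣!* (suc k) m Q m+i∣Q = ∣m+n∣m⇒∣n ∣sum ∣first
  where
  A = k ! * Q
  split : (m + suc k) * A ≡ m * A + suc k ! * Q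
  split = begin
    (m + suc k) * A          ≡⟨ *-distribʳ-+ A m (suc k) ⟩
    m * A + suc k * A        ≡⟨ cong (_+_ (m * A)) (*-assoc (suc k) (k !) Q) ⟨
    m * A + suc k ! * Q      ∎
    where open ≡-Reasoning
  ∣sum : rising m (suc k) ∣ m * A + suc k ! * Q
  ∣sum = subst₂ _∣_ (*-comm (m + suc k) _) split
    (*-monoʳ-∣ (m + suc k) (rising∣!* k m Q (λ i i≤k → m+i∣Q i (m≤n⇒m≤1+n i≤k))))
  ∣first : rising m (suc k) ∣ m * A
  ∣first = subst (_∣ m * A) (sym (rising-suc m k)) (*-monoʳ-∣ m
    (rising∣!* k (suc m) Q (λ i i≤k → subst (_∣ Q) (+-suc m i) (m+i∣Q (suc i) (s≤s i≤k)))))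

-- Factorwise: m + i ≥ 2 (i + 1) for every i ≤ k.
2^[1+k]*[1+k]!≤rising : ∀ k m → k + 2 ≤ m → 2 ^ suc k * suc k ! ≤ rising m k
2^[1+k]*[1+k]!≤rising zero    m k+2≤m = k+2≤m
2^[1+k]*[1+k]!≤rising (suc k) m k+2≤m = begin
  2 ^ suc (suc k) * suc (suc k) !          ≡⟨ regroup (2 ^ suc k) (suc k !) (suc (suc k)) ⟩
  2 ^ suc k * suc k ! * (2 * suc (suc k))  ≤⟨ *-mono-≤ (2^[1+k]*[1+k]!≤rising k m (≤-trans (n≤1+n (k + 2)) k+2≤m)) last ⟩
  rising m k * (m + suc k)                 ∎
  where
  open ≤-Reasoning
  regroup : ∀ a b c → 2 * a * (c * b) ≡ a * b * (2 * c)
  regroup = solve-∀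
  double : ∀ k → 2 * suc (suc k) ≡ (suc k + 2) + suc k
  double = solve-∀
  last : 2 * suc (suc k) ≤ m + suc k
  last = begin
    2 * suc (suc k)          ≡⟨ double k ⟩
    (suc k + 2) + suc k      ≤⟨ +-monoˡ-≤ (suc k) k+2≤m ⟩
    m + suc k                ∎

2^[1+k]≤common-multiple : ∀ k Q .{{_ : NonZero Q}} →
  (∀ i → i ≤ k → suc (suc k) + i ∣ Q) → 2 ^ suc k ≤ Q
2^[1+k]≤common-multiple k Q ∣Q = ≤-trans (m≤m*n (2 ^ suc k) (suc k))
  (*-cancelʳ-≤ _ _ (k !) {{k !≢0}} (begin
    2 ^ suc k * suc k * k !      ≡⟨ *-assoc (2 ^ suc k) (suc k) (k !) ⟩
    2 ^ suc k * suc k !          ≤⟨ 2^[1+k]*[1+k]!≤rising k (suc (suc k)) (≤-reflexive (+-comm k 2)) ⟩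
    rising (suc (suc k)) k       ≤⟨ ∣⇒≤ {{m*n≢0 (k !) Q {{k !≢0}}}} (rising∣!* k (suc (suc k)) Q ∣Q) ⟩
    k ! * Q                      ≡⟨ *-comm (k !) Q ⟩
    Q * k !                      ∎))
  where open ≤-Reasoning

sq16 : ℕ → ℕ
sq16 q = 16 * suc q * suc q + 1

-- 5 sq16 q − 4 sq16 (q + 1) = 16 r² + 160 r + 81 for q = r + 8.
4*sq16[1+q]≤5*sq16[q] : ∀ q → 8 ≤ q → 4 * sq16 (suc q) ≤ 5 * sq16 q
4*sq16[1+q]≤5*sq16[q] q 8≤q with q ∸ 8 | m∸n+n≡m 8≤q
... | r | refl = subst (4 * sq16 (suc (r + 8)) ≤_) (expand r) (m≤m+n _ _)
  where
  expand : ∀ r → 4 * (16 * suc (suc (r + 8)) * suc (suc (r + 8)) + 1) + (16 * r * r + 160 * r + 81)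
                 ≡ 5 * (16 * suc (r + 8) * suc (r + 8) + 1)
  expand = solve-∀

sq16²≤2^[d+32] : ∀ d → sq16 (d + 32) * sq16 (d + 32) ≤ 2 ^ (d + 32)
sq16²≤2^[d+32] zero    = ≤ᵇ⇒≤ _ _ _
sq16²≤2^[d+32] (suc d) = *-cancelˡ-≤ 16 (begin
  16 * (x′ * x′)          ≡⟨ square 4 x′ ⟩
  (4 * x′) * (4 * x′)     ≤⟨ *-mono-≤ step step ⟩
  (5 * x) * (5 * x)       ≡⟨ square 5 x ⟨
  25 * (x * x)            ≤⟨ *-monoˡ-≤ (x * x) (≤ᵇ⇒≤ 25 32 _) ⟩
  32 * (x * x)            ≤⟨ *-monoʳ-≤ 32 (sq16²≤2^[d+32] d) ⟩
  32 * 2 ^ (d + 32)       ≡⟨ *-assoc 16 2 (2 ^ (d + 32)) ⟩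
  16 * 2 ^ suc (d + 32)   ∎)
  where
  open ≤-Reasoning
  x  = sq16 (d + 32)
  x′ = sq16 (suc (d + 32))
  step : 4 * x′ ≤ 5 * x
  step = 4*sq16[1+q]≤5*sq16[q] (d + 32) (≤-trans (≤ᵇ⇒≤ 8 32 _) (m≤n+m 32 d))
  square : ∀ a x → a * a * (x * x) ≡ (a * x) * (a * x)
  square = solve-∀

sq16²≤2^ : ∀ q → 32 ≤ q → sq16 q * sq16 q ≤ 2 ^ q
sq16²≤2^ q 32≤q = subst (λ p → sq16 p * sq16 p ≤ 2 ^ p) (m∸n+n≡m 32≤q) (sq16²≤2^[d+32] (q ∸ 32))

⌊n/2⌋+⌊n/2⌋≤n : ∀ n → ⌊ n /2⌋ + ⌊ n /2⌋ ≤ n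
⌊n/2⌋+⌊n/2⌋≤n zero          = z≤n
⌊n/2⌋+⌊n/2⌋≤n (suc zero)    = z≤n
⌊n/2⌋+⌊n/2⌋≤n (suc (suc n)) =
  s≤s (subst (_≤ suc n) (sym (+-suc ⌊ n /2⌋ ⌊ n /2⌋)) (s≤s (⌊n/2⌋+⌊n/2⌋≤n n)))

n≤1+⌊n/2⌋+⌊n/2⌋ : ∀ n → n ≤ suc (⌊ n /2⌋ + ⌊ n /2⌋)
n≤1+⌊n/2⌋+⌊n/2⌋ zero          = z≤n
n≤1+⌊n/2⌋+⌊n/2⌋ (suc zero)    = s≤s z≤n
n≤1+⌊n/2⌋+⌊n/2⌋ (suc (suc n)) =
  s≤s (s≤s (subst (n ≤_) (sym (+-suc ⌊ n /2⌋ ⌊ n /2⌋)) (n≤1+⌊n/2⌋+⌊n/2⌋ n)))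

2+q*c+i≤n*c : ∀ q c n → 2 ≤ c → suc (q + q) ≤ n → ∀ i → i ≤ q * c → suc (suc (q * c)) + i ≤ n * c
2+q*c+i≤n*c q c n 2≤c 1+2q≤n i i≤qc = begin
  suc (suc (q * c)) + i      ≤⟨ +-monoʳ-≤ (suc (suc (q * c))) i≤qc ⟩
  2 + q * c + q * c          ≤⟨ +-monoˡ-≤ (q * c) (+-monoˡ-≤ (q * c) 2≤c) ⟩
  c + q * c + q * c          ≡⟨ regroup q c ⟩
  suc (q + q) * c            ≤⟨ *-monoˡ-≤ c 1+2q≤n ⟩
  n * c                      ∎
  where
  open ≤-Reasoning
  regroup : ∀ q c → c + q * c + q * c ≡ suc (q + q) * c
  regroup = solve-∀

4n²+1≤sq16 : ∀ n q → n ≤ 2 * suc q → 4 * n * n + 1 ≤ sq16 q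
4n²+1≤sq16 n q n≤ = +-monoˡ-≤ 1 (begin
  4 * n * n                        ≤⟨ *-mono-≤ (*-monoʳ-≤ 4 n≤) n≤ ⟩
  4 * (2 * suc q) * (2 * suc q)    ≡⟨ regroup (suc q) ⟩
  16 * suc q * suc q               ∎)
  where
  open ≤-Reasoning
  regroup : ∀ p → 4 * (2 * p) * (2 * p) ≡ 16 * p * p
  regroup = solve-∀

-- For K = ⌊(n-1)/2⌋ n² s the window K + 2, …, 2K + 2 lies below n³ s, while
-- (4n² + 1)^(2n²s) ≤ 2^K because (4n² + 1)² ≤ 2^⌊(n-1)/2⌋.
no-small-common-multiple : ∀ n s Q .{{_ : NonZero Q}} → 65 ≤ n → 1 ≤ s →
  Q ≤ (4 * n * n + 1) ^ (2 * (n * n * s)) →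
  ¬ (∀ j → suc (suc j) ≤ n ^ 3 * s → suc (suc j) ∣ Q)
no-small-common-multiple n@(suc x) s Q 65≤n 1≤s Q≤M^[2c] ∣Q =
  <⇒≱ (^-monoʳ-< 2 (s≤s (s≤s z≤n)) (n<1+n K)) (≤-trans 2^[1+K]≤Q Q≤2^K)
  where
  q = ⌊ x /2⌋
  c = n * n * s
  K = q * c
  M = 4 * n * n + 1
  M*M≤2^q : M * M ≤ 2 ^ q
  M*M≤2^q = ≤-trans (*-mono-≤ M≤ M≤) (sq16²≤2^ q (⌊n/2⌋-mono (s≤s⁻¹ 65≤n)))
    where
    M≤ : M ≤ sq16 q
    M≤ = 4n²+1≤sq16 n q (≤-trans (s≤s (n≤1+⌊n/2⌋+⌊n/2⌋ x)) (≤-reflexive (double q)))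
      where
      double : ∀ p → suc (suc (p + p)) ≡ 2 * suc p
      double = solve-∀
  Q≤2^K : Q ≤ 2 ^ K
  Q≤2^K = begin
    Q                 ≤⟨ Q≤M^[2c] ⟩
    M ^ (2 * c)       ≡⟨ ^-*-assoc M 2 c ⟨
    (M ^ 2) ^ c       ≡⟨ cong (λ m → (M * m) ^ c) (*-identityʳ M) ⟩
    (M * M) ^ c       ≤⟨ ^-monoˡ-≤ c M*M≤2^q ⟩
    (2 ^ q) ^ c       ≡⟨ ^-*-assoc 2 q c ⟩
    2 ^ K             ∎
    where open ≤-Reasoning
  2≤c : 2 ≤ c
  2≤c = ≤-trans (*-mono-≤ {1} {n} {2} {n} (≤-trans (s≤s z≤n) 65≤n) (≤-trans (s≤s (s≤s z≤n)) 65≤n))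
                (m≤m*n (n * n) s {{>-nonZero 1≤s}})
  n³s≡n*c : n ^ 3 * s ≡ n * c
  n³s≡n*c = cube n s
    where
    cube : ∀ n s → n * (n * (n * 1)) * s ≡ n * (n * n * s)
    cube = solve-∀
  2^[1+K]≤Q : 2 ^ suc K ≤ Q
  2^[1+K]≤Q = 2^[1+k]≤common-multiple K Q λ i i≤K →
    ∣Q (K + i) (subst (suc (suc K) + i ≤_) (sym n³s≡n*c)
                      (2+q*c+i≤n*c q c n 2≤c (s≤s (⌊n/2⌋+⌊n/2⌋≤n x)) i i≤K))

lookup-injective : ∀ {A : Set} {xs : List A} → Unique xs →
  ∀ i j → lookup xs i ≡ lookup xs j → i ≡ j
lookup-injective (_   ∷ _) zero    zero    _  = refl
lookup-injective (x∉ ∷ _) zero    (suc j) eq = contradiction eq (All.lookup x∉ (∈-lookup j))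
lookup-injective (x∉ ∷ _) (suc i) zero    eq = contradiction (sym eq) (All.lookup x∉ (∈-lookup i))
lookup-injective (_  ∷ u) (suc i) (suc j) eq = cong suc (lookup-injective u i j eq)

#E≤n*n : ∀ {n} (G : SimpleGraph n) → #E G ≤ n * n
#E≤n*n G = injective⇒≤ {f = code} code-injective
  where
  code : Fin (#E G) → Fin _
  code j = combine (proj₁ (lookup (edges G) j)) (proj₂ (lookup (edges G) j))
  code-injective : ∀ {i j} → code i ≡ code j → i ≡ j
  code-injective {i} {j} eq with combine-injective _ _ _ _ eq
  ... | u≡u′ , v≡v′ = lookup-injective (unique G) i j (cong₂ _,_ u≡u′ v≡v′)

f≤Σℕf : ∀ m (f : Fin m → ℕ) j → f j ≤ Σℕ m f
f≤Σℕf (suc m) f zero    = m≤m+n _ _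
f≤Σℕf (suc m) f (suc j) = ≤-trans (f≤Σℕf m (f ∘ suc) j) (m≤n+m _ _)

product≤^length : ∀ {B} {ns : List ℕ} → All (_≤ B) ns → product ns ≤ B ^ length ns
product≤^length []             = ≤-refl
product≤^length (n≤B ∷ ns≤B) = *-mono-≤ n≤B (product≤^length ns≤B)

<∸1⇒2+≤ : ∀ {j t} → j < t ∸ 1 → 2 + j ≤ t
<∸1⇒2+≤ {t = suc t} j<t = s≤s j<t

module _ {n} (G : SimpleGraph n) where

  private
    M : ℕ
    M = 4 * n * n + 1
    m : ℕ
    m = #E G

    1+4n²≡M : suc (4 * n ^ 2) ≡ M
    1+4n²≡M = expand n
      where
      expand : ∀ n → suc (4 * (n * (n * 1))) ≡ 4 * n * n + 1
      expand = solve-∀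
    instance
      M≢0 : NonZero M
      M≢0 = subst NonZero 1+4n²≡M _

  encode : ℤ^E G → ℤ
  encode y = Σℤ m (λ j → y j ℤ.* + (M ^ suc (toℕ j)))

  encode≢0 : ∀ y → NonZeroVec {G = G} y → ‖_‖₁ {G = G} y ≤ 4 * n ^ 2 → NonZero ∣ encode y ∣
  encode≢0 y y≢0 ‖y‖≤ = ≢-nonZero λ ∣encode∣≡0 →
    y≢0 (baseValue≡0⇒digits≡0 M m y ∣y∣<M (∣i∣≡0⇒i≡0 (m*n≡0⇒m≡0 _ M (∣value∣*M≡0 ∣encode∣≡0))))
    where
    ∣y∣<M : ∀ j → ∣ y j ∣ < M
    ∣y∣<M j = ≤-trans (s≤s (≤-trans (f≤Σℕf m (∣_∣ ∘ y) j) ‖y‖≤)) (≤-reflexive 1+4n²≡M)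
    ∣value∣*M≡0 : ∣ encode y ∣ ≡ 0 → ∣ baseValue M m y ∣ * M ≡ 0
    ∣value∣*M≡0 ∣encode∣≡0 = begin
      ∣ baseValue M m y ∣ * M        ≡⟨ *-comm _ M ⟩
      M * ∣ baseValue M m y ∣        ≡⟨ abs-* (+ M) (baseValue M m y) ⟨
      ∣ + M ℤ.* baseValue M m y ∣    ≡⟨ cong ∣_∣ (Σℤ-scale m M y (λ j → M ^ toℕ j)) ⟨
      ∣ encode y ∣                   ≡⟨ ∣encode∣≡0 ⟩
      0                              ∎
      where open ≡-Reasoning

  ∣encode∣≤M^[1+m] : ∀ y → ‖_‖₁ {G = G} y ≤ 4 * n ^ 2 → ∣ encode y ∣ ≤ M ^ suc m
  ∣encode∣≤M^[1+m] y ‖y‖≤ = begin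
    ∣ encode y ∣             ≤⟨ ∣Σℤ*∣≤Σℕ∣∣*B m y (λ j → M ^ suc (toℕ j)) (M ^ m) (λ j → ^-monoʳ-≤ M (toℕ<n j)) ⟩
    ‖_‖₁ {G = G} y * M ^ m   ≤⟨ *-monoˡ-≤ (M ^ m) (≤-trans (≤-trans ‖y‖≤ (n≤1+n _)) (≤-reflexive 1+4n²≡M)) ⟩
    M * M ^ m                ∎
    where open ≤-Reasoning

  weights-cannot-all-vanish : ∀ {s} (y : Fin s → ℤ^E G) → 65 ≤ n → 1 ≤ s →
    (∀ i → NonZeroVec {G = G} (y i)) → (∀ i → ‖_‖₁ {G = G} (y i) ≤ 4 * n ^ 2) →
    ¬ (∀ j → 2 + j ≤ n ^ 3 * s → Σ (Fin s) λ i → ⟨_,_⟩ {G = G} (y i) (w G (2 + j)) ≡ + 0)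
  weights-cannot-all-vanish {s} y 65≤n 1≤s y≢0 ‖y‖≤ vanish =
    no-small-common-multiple n s Q {{Q≢0}} 65≤n 1≤s Q≤M^[2n²s] 2+j∣Q
    where
    encodings : List ℕ
    encodings = tabulate (∣_∣ ∘ encode ∘ y)
    Q = product encodings
    Q≢0 : NonZero Q
    Q≢0 = product≢0 (tabulate⁺ λ i → encode≢0 (y i) (y≢0 i) (‖y‖≤ i))
    1+m≤2n² : suc m ≤ 2 * (n * n)
    1+m≤2n² = ≤-trans (+-mono-≤ (*-mono-≤ 1≤n 1≤n) (#E≤n*n G))
                      (≤-reflexive (cong (_+_ (n * n)) (sym (+-identityʳ (n * n)))))
      where
      1≤n : 1 ≤ n
      1≤n = ≤-trans (s≤s z≤n) 65≤n
    Q≤M^[2n²s] : Q ≤ M ^ (2 * (n * n * s))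
    Q≤M^[2n²s] = begin
      Q                                 ≤⟨ product≤^length (tabulate⁺ λ i → ∣encode∣≤M^[1+m] (y i) (‖y‖≤ i)) ⟩
      (M ^ suc m) ^ length encodings    ≡⟨ cong ((M ^ suc m) ^_) (length-tabulate (∣_∣ ∘ encode ∘ y)) ⟩
      (M ^ suc m) ^ s                   ≡⟨ ^-*-assoc M (suc m) s ⟩
      M ^ (suc m * s)                   ≤⟨ ^-monoʳ-≤ M (*-monoˡ-≤ s 1+m≤2n²) ⟩
      M ^ (2 * (n * n) * s)             ≡⟨ cong (M ^_) (*-assoc 2 (n * n) s) ⟩
      M ^ (2 * (n * n * s))             ∎
      where open ≤-Reasoning
    2+j∣Q : ∀ j → 2 + j ≤ n ^ 3 * s → 2 + j ∣ Q
    2+j∣Q j 2+j≤ with vanish j 2+j≤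
    ... | i , ⟨y,w⟩≡0 = ∣-trans (Σℤ%≡0⇒∣Σℤ m (2 + j) (y i) (λ j → M ^ suc (toℕ j)) ⟨y,w⟩≡0)
                                (∈⇒∣product (∈-tabulate⁺ i))

  vanishes? : ∀ {s} (y : Fin s → ℤ^E G) j →
    Dec (Σ (Fin s) λ i → ⟨_,_⟩ {G = G} (y i) (w G (2 + j)) ≡ + 0)
  vanishes? y j = any? λ i → ⟨_,_⟩ {G = G} (y i) (w G (2 + j)) ℤ.≟ + 0

  some-weight-survives : ∀ {s} (y : Fin s → ℤ^E G) → 65 ≤ n → 1 ≤ s →
    (∀ i → NonZeroVec {G = G} (y i)) → (∀ i → ‖_‖₁ {G = G} (y i) ≤ 4 * n ^ 2) →
    ∃ λ j → 2 + j ≤ n ^ 3 * s × ∀ i → ⟨_,_⟩ {G = G} (y i) (w G (2 + j)) ≢ + 0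
  some-weight-survives {s} y 65≤n 1≤s y≢0 ‖y‖≤
    with anyUpTo? (¬? ∘ vanishes? y) (n ^ 3 * s ∸ 1)
  ... | yes (j , j<T∸1 , survives) = j , <∸1⇒2+≤ j<T∸1 , λ i ⟨y,w⟩≡0 → survives (i , ⟨y,w⟩≡0)
  ... | no none-survives = contradiction
    (λ j 2+j≤T → decidable-stable (vanishes? y j) λ survives → none-survives (j , ∸-monoˡ-≤ 1 2+j≤T , survives))
    (weights-cannot-all-vanish y 65≤n 1≤s y≢0 ‖y‖≤)

lemma3p4 : Σ ℕ λ N → (n : ℕ) → N ≤ n → (G : SimpleGraph n) →
    (s : ℕ) → 1 ≤ s → (y : Fin s → ℤ^E G) →
    (∀ i → NonZeroVec {G = G} (y i)) →
    (∀ i → ‖_‖₁ {G = G} (y i) ≤ 4 * n ^ 2) →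
    Σ (ℤ^E G) λ x → _∈𝒲_ {G = G} x (n ^ 3 * s) ×
    (∀ i → ⟨_,_⟩ {G = G} (y i) x ≢ + 0)
lemma3p4 = 65 , λ n 65≤n G s 1≤s y y≢0 ‖y‖≤ →
  let j , 2+j≤n³s , survives = some-weight-survives G y 65≤n 1≤s y≢0 ‖y‖≤
  in  w G (2 + j) , (2 + j , s≤s (s≤s z≤n) , 2+j≤n³s , λ _ _ → refl) , survives
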